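{- Let $p$ be a prime with $p\equiv 1\pmod 4$, and let $g\in\{1,\ldots,p-1\}$ be an integer which is a primitive root modulo $p$. Let $\zeta=e^{2\pi\mathbf i/(p-1)}$, and let $\mathfrak p$ be a prime ideal of the ring of integers of the cyclotomic field $\mathbb Q(\zeta)$ with $\mathfrak p\mid p$ such that $g\equiv\zeta\pmod{\mathfrak p}$. Then $$\prod_{1\leq i<j\leq \frac{p-1}{2}}(g^{2j}-g^{2i})\equiv e^{\frac{(p-3)(3p+1)}{16}\pi\mathbf i}\cdot\Big(\frac{p-1}{2}\Big)^{\frac{p-1}{4}}\pmod{\mathfrak p},$$ where $\mathbf i=\sqrt{ -1}$.
   Context: Congruences modulo $\mathfrak p$ are taken in the ring of integers $\mathbb Z[\zeta]$ of $\mathbb Q(\zeta)$; the right-hand side lies in this ring since $\mathbf i=\zeta^{(p-1)/4}$. -}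

module Defs where

open import Data.Nat as ℕ using (ℕ; zero; suc; _∸_; _/_; _≤_; _<_)
open import Data.Integer as ℤ using (ℤ; +_; _-_; _*_; _^_)
open import Data.Integer.Divisibility using (_∣_)
open import Relation.Nullary using (¬_)
open import Data.Product using (_×_)

_≡_[mod_] : ℤ → ℤ → ℕ → Set
a ≡ b [mod p ] = (+ p) ∣ (a - b)

-- g is a primitive root modulo p: g^k ≢ 1 (mod p) for 1 ≤ k < p-1,
-- (together with g^(p-1) ≡ 1, which for prime p and 1 ≤ g ≤ p-1 is Fermat).
PrimitiveRoot : ℕ → ℕ → Set
PrimitiveRoot p g =
  (((+ g) ^ (p ∸ 1)) ≡ (+ 1) [mod p ]) × (∀ k → 1 ≤ k → k < p ∸ 1 → ¬ (((+ g) ^ k) ≡ (+ 1) [mod p ]))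

innerProd : (ℕ → ℕ → ℤ) → ℕ → ℕ → ℤ
innerProd f j zero    = + 1
innerProd f j (suc m) = innerProd f j m * f (suc m) j

-- pairProd f n = ∏_{1 ≤ i < j ≤ n} f i j
pairProd : (ℕ → ℕ → ℤ) → ℕ → ℤ
pairProd f zero    = + 1
pairProd f (suc n) = pairProd f n * innerProd f (suc n) n

lhs : ℕ → ℕ → ℤ
lhs p g = pairProd (λ i j → (+ g) ^ (2 ℕ.* j) - (+ g) ^ (2 ℕ.* i)) ((p ∸ 1) / 2)

-- Image of i = ζ^((p-1)/4) in Z[ζ]/𝔭 ≅ F_p, where ζ ↦ g.
iImage : ℕ → ℕ → ℤ
iImage p g = (+ g) ^ ((p ∸ 1) / 4)

-- Right-hand side image: e^{(p-3)(3p+1)/16 · π i} = i^{(p-3)(3p+1)/8}, times ((p-1)/2)^{(p-1)/4}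
rhs : ℕ → ℕ → ℤ
rhs p g = iImage p g ^ (((p ∸ 3) ℕ.* (3 ℕ.* p ℕ.+ 1)) / 8)
        * (+ ((p ∸ 1) / 2)) ^ ((p ∸ 1) / 4)

{-# OPTIONS --safe #-}
module Submission where

-- Put h = g², an element of order n = (p-1)/2 = 2m modulo p, and note g^n ≡ -1.
-- Factoring h^i out of h^j - h^i turns the j-th row of the product into
-- h^(j(j-1)/2) · E(j-1), where E(k) = ∏_{e=1}^{k} (h^e - 1).  Modulo p,
-- h^e - 1 ≡ -h^e (h^(n-e) - 1) = g^(n+2e) (h^(n-e) - 1), so the rows k and
-- n-1-k combine to E(n-1) times a power of g.  Finally E(n-1) ≡ (-1)^(n-1) n:
-- F(x) = ∏_{e=0}^{n-1} (x - h^e) satisfies F(hx) = h^n F(x) ≡ F(x), so its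
-- coefficients of x, …, x^(n-1) vanish; hence all coefficients of
-- F(x)/(x-1) = ∏_{e=1}^{n-1} (x - h^e) are equal to the leading one, and its
-- value at x = 1 is n.  What remains is to reduce the exponent of g modulo 4m.

open import Defs
open import Data.Nat as ℕ using (ℕ; zero; suc; _∸_; _%_; _/_; _≤_; _<_; z≤n; s≤s)
import Data.Nat.Properties as ℕ
import Data.Nat.Divisibility as ℕ
import Data.Nat.Tactic.RingSolver as ℕ-Solver
open import Data.Nat.DivMod using (m≡m%n+[m/n]*n; m*n/n≡m)
open import Data.Nat.Primality using (Prime; euclidsLemma; ¬prime[1])
open import Data.Product using (_,_)
open import Data.Sum using (_⊎_; inj₁; inj₂; [_,_]′)
open import Data.Empty using (⊥-elim)
open import Function using (id; _∘_)
open import Relation.Nullary using (¬_)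
open import Relation.Binary.Bundles using (Setoid)
open import Relation.Binary.PropositionalEquality
  using (_≡_; _≗_; refl; sym; trans; cong; cong₂; subst; module ≡-Reasoning)
import Relation.Binary.Reasoning.Setoid as SetoidReasoning

module _ where
  open import Data.Nat using (_+_; _*_)

  ∑ : ℕ → (ℕ → ℕ) → ℕ
  ∑ zero    f = 0
  ∑ (suc n) f = ∑ n f + f n

  syntax ∑ n (λ i → f) = ∑[ i < n ] f

  ∑-arithmetic : ∀ c s → ∑[ t < s ] (c + 2 * suc t) ≡ s * (s + suc c)
  ∑-arithmetic c zero    = refl
  ∑-arithmetic c (suc s) = trans (cong (_+ (c + 2 * suc s)) (∑-arithmetic c s)) (step c s)
    where
    step : ∀ c s → s * (s + suc c) + (c + 2 * suc s) ≡ suc s * (suc s + suc c)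
    step = ℕ-Solver.solve-∀

  ∑-quadratic : ∀ a b c →
    6 * ∑[ i < suc c ] ((a + i) * (a + i + b))
      ≡ 6 * suc c * a * (a + b) + 3 * (2 * a + b) * suc c * c + suc c * c * (2 * c + 1)
  ∑-quadratic a b zero    = base a b
    where
    base : ∀ a b → 6 * (0 + (a + 0) * (a + 0 + b))
                     ≡ 6 * 1 * a * (a + b) + 3 * (2 * a + b) * 1 * 0 + 1 * 0 * (2 * 0 + 1)
    base = ℕ-Solver.solve-∀
  ∑-quadratic a b (suc c) = begin
    6 * (∑ (suc c) q + q (suc c))    ≡⟨ ℕ.*-distribˡ-+ 6 (∑ (suc c) q) (q (suc c)) ⟩
    6 * ∑ (suc c) q + 6 * q (suc c)  ≡⟨ cong (_+ 6 * q (suc c)) (∑-quadratic a b c) ⟩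
    _                                ≡⟨ step a b c ⟩
    _                                ∎
    where
    open ≡-Reasoning
    q : ℕ → ℕ
    q i = (a + i) * (a + i + b)
    step : ∀ a b c →
      6 * suc c * a * (a + b) + 3 * (2 * a + b) * suc c * c + suc c * c * (2 * c + 1)
        + 6 * ((a + suc c) * (a + suc c + b))
      ≡ 6 * suc (suc c) * a * (a + b) + 3 * (2 * a + b) * suc (suc c) * suc c
        + suc (suc c) * suc c * (2 * suc c + 1)
    step = ℕ-Solver.solve-∀

  ∑-pentagonal : ∀ r → 2 * ∑[ i < suc r ] (3 * i + 1) ≡ suc r * (3 * r + 2)
  ∑-pentagonal zero    = refl
  ∑-pentagonal (suc r) = begin
    2 * (∑ (suc r) t + t (suc r))    ≡⟨ ℕ.*-distribˡ-+ 2 (∑ (suc r) t) (t (suc r)) ⟩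
    2 * ∑ (suc r) t + 2 * t (suc r)  ≡⟨ cong (_+ 2 * t (suc r)) (∑-pentagonal r) ⟩
    _                                ≡⟨ step r ⟩
    _                                ∎
    where
    open ≡-Reasoning
    t : ℕ → ℕ
    t i = 3 * i + 1
    step : ∀ r → suc r * (3 * r + 2) + 2 * (3 * suc r + 1) ≡ suc (suc r) * (3 * suc r + 2)
    step = ℕ-Solver.solve-∀

  -- For P = 4m + 1: n = (P-1)/2 = d + 1 and K = (P-3)(3P+1)/8.  In the exponent
  -- of g, S comes from the rows of the product, Q from pairing them up, ndm from
  -- the signs (-1)^d ≡ g^(nd), and 4mX is a multiple of the order of g.
  module Exponents (r : ℕ) where
    m n d K : ℕ
    m = suc r
    n = m + m
    d = r + m
    K = d * (3 * m + 1)

    S Q X : ℕ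
    S = ∑[ j < n ] (j * (j + 1))
    Q = ∑[ i < m ] ((m + i) * (m + i + suc n))
    X = ∑[ i < m ] (3 * i + 1)

    S+ndm+Q≡mK+4mX : S + n * d * m + Q ≡ m * K + (n + n) * X
    S+ndm+Q≡mK+4mX = ℕ.*-cancelˡ-≡ _ _ 6 (begin
      6 * (S + n * d * m + Q)                   ≡⟨ distrib S (n * d * m) Q ⟩
      6 * S + 6 * (n * d * m) + 6 * Q           ≡⟨ cong₂ (λ a b → a + 6 * (n * d * m) + b)
                                                         (∑-quadratic 0 1 d) (∑-quadratic m (suc n) r) ⟩
      _                                         ≡⟨ closed-forms r ⟩
      6 * (m * K) + 12 * m * (m * (3 * r + 2))  ≡⟨ cong (λ x → 6 * (m * K) + 12 * m * x) (∑-pentagonal r) ⟨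
      6 * (m * K) + 12 * m * (2 * X)            ≡⟨ collect (m * K) m X ⟩
      6 * (m * K + (n + n) * X)                 ∎)
      where
      open ≡-Reasoning
      distrib : ∀ a b c → 6 * (a + b + c) ≡ 6 * a + 6 * b + 6 * c
      distrib = ℕ-Solver.solve-∀
      collect : ∀ a m x → 6 * a + 12 * m * (2 * x) ≡ 6 * (a + ((m + m) + (m + m)) * x)
      collect = ℕ-Solver.solve-∀
      closed-forms : ∀ r → let m = suc r ; n = m + m ; d = r + m in
        6 * suc d * 0 * (0 + 1) + 3 * (2 * 0 + 1) * suc d * d + suc d * d * (2 * d + 1)
          + 6 * (n * d * m)
          + (6 * suc r * m * (m + suc n) + 3 * (2 * m + suc n) * suc r * r + suc r * r * (2 * r + 1))
        ≡ 6 * (m * (d * (3 * m + 1))) + 12 * m * (m * (3 * r + 2))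
      closed-forms = ℕ-Solver.solve-∀

    P : ℕ
    P = suc (m * 4)

    [P-1]/4≡m : (P ∸ 1) / 4 ≡ m
    [P-1]/4≡m = m*n/n≡m m 4

    [P-1]/2≡n : (P ∸ 1) / 2 ≡ n
    [P-1]/2≡n = trans (cong (_/ 2) (eq r)) (m*n/n≡m n 2)
      where
      eq : ∀ r → suc r * 4 ≡ (suc r + suc r) * 2
      eq = ℕ-Solver.solve-∀

    [P-3][3P+1]/8≡K : ((P ∸ 3) * (3 * P + 1)) / 8 ≡ K
    [P-3][3P+1]/8≡K = trans (cong (_/ 8) (eq r)) (m*n/n≡m K 8)
      where
      eq : ∀ r → suc (suc (r * 4)) * (3 * suc (suc r * 4) + 1) ≡ (r + suc r) * (3 * suc r + 1) * 8
      eq = ℕ-Solver.solve-∀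

open import Data.Integer as ℤ using (ℤ; +_; 0ℤ; 1ℤ; -1ℤ; _+_; _-_; _*_; -_; _^_; ∣_∣)
import Data.Integer.Properties as ℤ
open import Data.Integer.Divisibility.Signed as ℤ∣ using (∣ᵤ⇒∣; ∣⇒∣ᵤ)
open import Data.Integer.Tactic.RingSolver using (solve-∀)

∏ : ℕ → (ℕ → ℤ) → ℤ
∏ zero    f = 1ℤ
∏ (suc n) f = ∏ n f * f n

syntax ∏ n (λ i → f) = ∏[ i < n ] f

innerProd≡∏ : ∀ f J j → innerProd f J j ≡ ∏[ i < j ] f (suc i) J
innerProd≡∏ f J zero    = refl
innerProd≡∏ f J (suc j) = cong (_* f (suc j) J) (innerProd≡∏ f J j)

pairProd≡∏ : ∀ f n → pairProd f n ≡ ∏[ j < n ] innerProd f (suc j) j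
pairProd≡∏ f zero    = refl
pairProd≡∏ f (suc n) = cong (_* innerProd f (suc n) n) (pairProd≡∏ f n)

∏-cong : ∀ n {f g : ℕ → ℤ} → (∀ {i} → i < n → f i ≡ g i) → ∏ n f ≡ ∏ n g
∏-cong zero    f≡g = refl
∏-cong (suc n) f≡g = cong₂ _*_ (∏-cong n (λ i<n → f≡g (ℕ.m<n⇒m<1+n i<n))) (f≡g ℕ.≤-refl)

∏-* : ∀ n (f g : ℕ → ℤ) → ∏[ i < n ] (f i * g i) ≡ ∏ n f * ∏ n g
∏-* zero    f g = refl
∏-* (suc n) f g = trans (cong (_* (f n * g n)) (∏-* n f g)) (swap (∏ n f) (∏ n g) (f n) (g n))
  where
  swap : ∀ a b c d → a * b * (c * d) ≡ a * c * (b * d)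
  swap = solve-∀

∏-const : ∀ n c → ∏[ i < n ] c ≡ c ^ n
∏-const zero    c = refl
∏-const (suc n) c = trans (cong (_* c) (∏-const n c)) (ℤ.*-comm (c ^ n) c)

^-distribʳ-* : ∀ x y k → (x * y) ^ k ≡ x ^ k * y ^ k
^-distribʳ-* x y k = begin
  (x * y) ^ k                  ≡⟨ ∏-const k (x * y) ⟨
  ∏[ i < k ] (x * y)           ≡⟨ ∏-* k (λ _ → x) (λ _ → y) ⟩
  ∏[ i < k ] x * ∏[ i < k ] y  ≡⟨ cong₂ _*_ (∏-const k x) (∏-const k y) ⟩
  x ^ k * y ^ k                ∎
  where open ≡-Reasoning

∏-^ : ∀ n x (e : ℕ → ℕ) → ∏[ i < n ] (x ^ e i) ≡ x ^ ∑ n e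
∏-^ zero    x e = refl
∏-^ (suc n) x e = trans (cong (_* x ^ e n) (∏-^ n x e)) (sym (ℤ.^-distribˡ-+-* x (∑ n e) (e n)))

∏-+ : ∀ m n (f : ℕ → ℤ) → ∏ (m ℕ.+ n) f ≡ ∏ m f * ∏[ i < n ] f (m ℕ.+ i)
∏-+ m zero    f = trans (cong (λ k → ∏ k f) (ℕ.+-identityʳ m)) (sym (ℤ.*-identityʳ (∏ m f)))
∏-+ m (suc n) f = begin
  ∏ (m ℕ.+ suc n) f                             ≡⟨ cong (λ k → ∏ k f) (ℕ.+-suc m n) ⟩
  ∏ (m ℕ.+ n) f * f (m ℕ.+ n)                   ≡⟨ cong (_* f (m ℕ.+ n)) (∏-+ m n f) ⟩
  ∏ m f * ∏[ i < n ] f (m ℕ.+ i) * f (m ℕ.+ n)  ≡⟨ ℤ.*-assoc (∏ m f) _ _ ⟩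
  ∏ m f * ∏[ i < suc n ] f (m ℕ.+ i)            ∎
  where open ≡-Reasoning

∏-reverse : ∀ n (f : ℕ → ℤ) → ∏[ i < n ] f (n ∸ suc i) ≡ ∏ n f
∏-reverse zero    f = refl
∏-reverse (suc n) f = begin
  ∏[ i < suc n ] f (n ∸ i)             ≡⟨ ∏-+ 1 n (λ i → f (n ∸ i)) ⟩
  1ℤ * f n * ∏[ i < n ] f (n ∸ suc i)  ≡⟨ cong₂ _*_ (ℤ.*-identityˡ (f n)) (∏-reverse n f) ⟩
  f n * ∏ n f                          ≡⟨ ℤ.*-comm (f n) (∏ n f) ⟩
  ∏ (suc n) f                          ∎
  where open ≡-Reasoning

module Congruence (p : ℕ) where

  -- A record rather than _≡_[mod p ] itself, so that Agda can infer both sides.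
  infix 4 _≈_
  record _≈_ (x y : ℤ) : Set where
    constructor fromMod
    field toMod : x ≡ y [mod p ]
  open _≈_ public

  private
    P∣ : ℤ → Set
    P∣ z = + p ℤ∣.∣ z

    from-∣ : ∀ {x y} z → P∣ z → z ≡ x - y → x ≈ y
    from-∣ z p∣z z≡x-y = fromMod (∣⇒∣ᵤ (subst P∣ z≡x-y p∣z))

    to-∣ : ∀ {x y} → x ≈ y → P∣ (x - y)
    to-∣ x≈y = ∣ᵤ⇒∣ (toMod x≈y)

  ≈-refl : ∀ {x} → x ≈ x
  ≈-refl {x} = from-∣ 0ℤ (ℤ∣.divides 0ℤ refl) (sym (ℤ.+-inverseʳ x))

  ≈-reflexive : ∀ {x y} → x ≡ y → x ≈ y
  ≈-reflexive refl = ≈-refl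

  ≈-sym : ∀ {x y} → x ≈ y → y ≈ x
  ≈-sym {x} {y} x≈y = from-∣ _ (ℤ∣.∣m⇒∣-m (to-∣ x≈y)) (eq x y)
    where
    eq : ∀ x y → - (x - y) ≡ y - x
    eq = solve-∀

  ≈-trans : ∀ {x y z} → x ≈ y → y ≈ z → x ≈ z
  ≈-trans {x} {y} {z} x≈y y≈z = from-∣ _ (ℤ∣.∣m∣n⇒∣m+n (to-∣ x≈y) (to-∣ y≈z)) (eq x y z)
    where
    eq : ∀ x y z → (x - y) + (y - z) ≡ x - z
    eq = solve-∀

  setoid : Setoid _ _
  setoid = record
    { Carrier = ℤ ; _≈_ = _≈_
    ; isEquivalence = record { refl = ≈-refl ; sym = ≈-sym ; trans = ≈-trans } }

  +-cong : ∀ {x y u v} → x ≈ y → u ≈ v → x + u ≈ y + v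
  +-cong {x} {y} {u} {v} x≈y u≈v = from-∣ _ (ℤ∣.∣m∣n⇒∣m+n (to-∣ x≈y) (to-∣ u≈v)) (eq x y u v)
    where
    eq : ∀ x y u v → (x - y) + (u - v) ≡ (x + u) - (y + v)
    eq = solve-∀

  *-cong : ∀ {x y u v} → x ≈ y → u ≈ v → x * u ≈ y * v
  *-cong {x} {y} {u} {v} x≈y u≈v =
    from-∣ _ (ℤ∣.∣m∣n⇒∣m+n (ℤ∣.∣m⇒∣m*n u (to-∣ x≈y)) (ℤ∣.∣n⇒∣m*n y (to-∣ u≈v))) (eq x y u v)
    where
    eq : ∀ x y u v → (x - y) * u + y * (u - v) ≡ x * u - y * v
    eq = solve-∀

  neg-cong : ∀ {x y} → x ≈ y → - x ≈ - y
  neg-cong {x} {y} x≈y = from-∣ _ (ℤ∣.∣m⇒∣-m (to-∣ x≈y)) (eq x y)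
    where
    eq : ∀ x y → - (x - y) ≡ - x - - y
    eq = solve-∀

  -‿cong : ∀ {x y u v} → x ≈ y → u ≈ v → x - u ≈ y - v
  -‿cong x≈y u≈v = +-cong x≈y (neg-cong u≈v)

  *-congˡ : ∀ {x y} z → x ≈ y → z * x ≈ z * y
  *-congˡ z = *-cong (≈-refl {z})

  *-congʳ : ∀ {x y} z → x ≈ y → x * z ≈ y * z
  *-congʳ z x≈y = *-cong x≈y (≈-refl {z})

  ^-cong : ∀ {x y} n → x ≈ y → x ^ n ≈ y ^ n
  ^-cong zero    x≈y = ≈-refl
  ^-cong (suc n) x≈y = *-cong x≈y (^-cong n x≈y)

  ∏-cong-≈ : ∀ n {f g : ℕ → ℤ} → (∀ {i} → i < n → f i ≈ g i) → ∏ n f ≈ ∏ n g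
  ∏-cong-≈ zero    f≈g = ≈-refl
  ∏-cong-≈ (suc n) f≈g = *-cong (∏-cong-≈ n (λ i<n → f≈g (ℕ.m<n⇒m<1+n i<n))) (f≈g ℕ.≤-refl)

  x≈y⇒x-y≈0 : ∀ {x y} → x ≈ y → x - y ≈ 0ℤ
  x≈y⇒x-y≈0 {x} {y} x≈y = from-∣ _ (to-∣ x≈y) (sym (ℤ.+-identityʳ (x - y)))

  x-y≈0⇒x≈y : ∀ {x y} → x - y ≈ 0ℤ → x ≈ y
  x-y≈0⇒x≈y {x} {y} x-y≈0 = from-∣ _ (to-∣ x-y≈0) (ℤ.+-identityʳ (x - y))

  ^-periodic : ∀ {x N} → x ^ N ≈ 1ℤ → ∀ a t → x ^ (a ℕ.+ N ℕ.* t) ≈ x ^ a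
  ^-periodic {x} {N} xᴺ≈1 a t = begin
    x ^ (a ℕ.+ N ℕ.* t)  ≡⟨ trans (ℤ.^-distribˡ-+-* x a (N ℕ.* t)) (cong (x ^ a *_) (sym (ℤ.^-*-assoc x N t))) ⟩
    x ^ a * (x ^ N) ^ t  ≈⟨ *-congˡ (x ^ a) (^-cong t xᴺ≈1) ⟩
    x ^ a * 1ℤ ^ t       ≡⟨ trans (cong (x ^ a *_) (ℤ.^-zeroˡ t)) (ℤ.*-identityʳ (x ^ a)) ⟩
    x ^ a                ∎
    where open SetoidReasoning setoid

  steps≈⇒≈last : ∀ (c : ℕ → ℤ) d → (∀ {j} → j < d → c j ≈ c (suc j)) → ∀ {j} → j ≤ d → c j ≈ c d
  steps≈⇒≈last c zero    steps z≤n = ≈-refl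
  steps≈⇒≈last c (suc d) steps {j} j≤1+d with ℕ.m≤n⇒m<n∨m≡n j≤1+d
  ... | inj₂ refl      = ≈-refl
  ... | inj₁ (s≤s j≤d) = ≈-trans (steps≈⇒≈last c d (λ i<d → steps (ℕ.m<n⇒m<1+n i<d)) j≤d) (steps ℕ.≤-refl)

  module _ (p-prime : Prime p) where

    x*y≈0⇒x≈0∨y≈0 : ∀ {x y} → x * y ≈ 0ℤ → x ≈ 0ℤ ⊎ y ≈ 0ℤ
    x*y≈0⇒x≈0∨y≈0 {x} {y} (fromMod xy≡0) with euclidsLemma ∣ x ∣ ∣ y ∣ p-prime (subst (p ℕ.∣_) ∣xy∣ xy≡0)
      where
      ∣xy∣ : ∣ x * y - 0ℤ ∣ ≡ ∣ x ∣ ℕ.* ∣ y ∣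
      ∣xy∣ = trans (cong ∣_∣ (ℤ.+-identityʳ (x * y))) (ℤ.abs-* x y)
    ... | inj₁ p∣x = inj₁ (fromMod (subst (p ℕ.∣_) (cong ∣_∣ (sym (ℤ.+-identityʳ x))) p∣x))
    ... | inj₂ p∣y = inj₂ (fromMod (subst (p ℕ.∣_) (cong ∣_∣ (sym (ℤ.+-identityʳ y))) p∣y))

    x*y≈y⇒x≈1∨y≈0 : ∀ {x y} → x * y ≈ y → x ≈ 1ℤ ⊎ y ≈ 0ℤ
    x*y≈y⇒x≈1∨y≈0 {x} {y} xy≈y with x*y≈0⇒x≈0∨y≈0 (≈-trans (≈-reflexive (eq x y)) (x≈y⇒x-y≈0 xy≈y))
      where
      eq : ∀ x y → (x - 1ℤ) * y ≡ x * y - y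
      eq = solve-∀
    ... | inj₁ x-1≈0 = inj₁ (x-y≈0⇒x≈y x-1≈0)
    ... | inj₂ y≈0   = inj₂ y≈0

    x*x≈1⇒x≈±1 : ∀ {x} → x * x ≈ 1ℤ → x ≈ 1ℤ ⊎ x ≈ -1ℤ
    x*x≈1⇒x≈±1 {x} x²≈1 with x*y≈0⇒x≈0∨y≈0 (≈-trans (≈-reflexive (eq x)) (x≈y⇒x-y≈0 x²≈1))
      where
      eq : ∀ x → (x - 1ℤ) * (x - -1ℤ) ≡ x * x - 1ℤ
      eq = solve-∀
    ... | inj₁ x-1≈0 = inj₁ (x-y≈0⇒x≈y x-1≈0)
    ... | inj₂ x+1≈0 = inj₂ (x-y≈0⇒x≈y x+1≈0)

-- Polynomials as coefficient sequences: shift c is x·c(x), mulRoot a c is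
-- (x - a)·c(x), dilate h c is c(hx), and coeffSum c (suc n) is c(1) when deg c ≤ n.
Poly : Set
Poly = ℕ → ℤ

one : Poly
one zero    = 1ℤ
one (suc k) = 0ℤ

shift : Poly → Poly
shift c zero    = 0ℤ
shift c (suc k) = c k

mulRoot : ℤ → Poly → Poly
mulRoot a c k = shift c k - a * c k

fromRoots : (ℕ → ℤ) → ℕ → Poly
fromRoots r zero    = one
fromRoots r (suc n) = mulRoot (r n) (fromRoots r n)

dilate : ℤ → Poly → Poly
dilate h c k = h ^ k * c k

coeffSum : Poly → ℕ → ℤ
coeffSum c zero    = 0ℤ
coeffSum c (suc n) = coeffSum c n + c n

mulRoot-cong : ∀ a {c d} → c ≗ d → mulRoot a c ≗ mulRoot a d
mulRoot-cong a c≗d zero    = cong (λ x → 0ℤ - a * x) (c≗d zero)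
mulRoot-cong a c≗d (suc k) = cong₂ (λ x y → x - a * y) (c≗d k) (c≗d (suc k))

mulRoot-comm : ∀ a b c → mulRoot a (mulRoot b c) ≗ mulRoot b (mulRoot a c)
mulRoot-comm a b c zero    = eq a b (c 0)
  where
  eq : ∀ a b x → 0ℤ - a * (0ℤ - b * x) ≡ 0ℤ - b * (0ℤ - a * x)
  eq = solve-∀
mulRoot-comm a b c (suc k) = eq a b (shift c k) (c k) (c (suc k))
  where
  eq : ∀ a b x y z → (x - b * y) - a * (y - b * z) ≡ (x - a * y) - b * (y - a * z)
  eq = solve-∀

fromRoots-front : ∀ r n → fromRoots r (suc n) ≗ mulRoot (r 0) (fromRoots (r ∘ suc) n)
fromRoots-front r zero    k = refl
fromRoots-front r (suc n) k = begin
  mulRoot (r (suc n)) (fromRoots r (suc n)) k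
    ≡⟨ mulRoot-cong (r (suc n)) (fromRoots-front r n) k ⟩
  mulRoot (r (suc n)) (mulRoot (r 0) (fromRoots (r ∘ suc) n)) k
    ≡⟨ mulRoot-comm (r (suc n)) (r 0) _ k ⟩
  mulRoot (r 0) (fromRoots (r ∘ suc) (suc n)) k
    ∎
  where open ≡-Reasoning

fromRoots-vanishes : ∀ r n {k} → n < k → fromRoots r n k ≡ 0ℤ
fromRoots-vanishes r zero    {suc k} _ = refl
fromRoots-vanishes r (suc n) {suc k} (s≤s n<k) = begin
  fromRoots r n k - r n * fromRoots r n (suc k)
    ≡⟨ cong₂ (λ x y → x - r n * y) (fromRoots-vanishes r n n<k) (fromRoots-vanishes r n (ℕ.m<n⇒m<1+n n<k)) ⟩
  0ℤ - r n * 0ℤ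
    ≡⟨ cong (λ x → 0ℤ - x) (ℤ.*-zeroʳ (r n)) ⟩
  0ℤ
    ∎
  where open ≡-Reasoning

fromRoots-monic : ∀ r n → fromRoots r n n ≡ 1ℤ
fromRoots-monic r zero    = refl
fromRoots-monic r (suc n) = begin
  fromRoots r n n - r n * fromRoots r n (suc n)
    ≡⟨ cong₂ (λ x y → x - r n * y) (fromRoots-monic r n) (fromRoots-vanishes r n ℕ.≤-refl) ⟩
  1ℤ - r n * 0ℤ
    ≡⟨ cong (λ x → 1ℤ - x) (ℤ.*-zeroʳ (r n)) ⟩
  1ℤ
    ∎
  where open ≡-Reasoning

dilate-fromRoots : ∀ h r n → dilate h (fromRoots (λ e → h * r e) n) ≗ λ k → h ^ n * fromRoots r n k
dilate-fromRoots h r zero    zero    = refl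
dilate-fromRoots h r zero    (suc k) = trans (ℤ.*-zeroʳ (h ^ suc k)) (sym (ℤ.*-zeroʳ 1ℤ))
dilate-fromRoots h r (suc n) zero    = begin
  1ℤ * (0ℤ - h * r n * c 0)    ≡⟨ eq h (r n) (c 0) ⟩
  0ℤ - h * r n * (1ℤ * c 0)    ≡⟨ cong (λ x → 0ℤ - h * r n * x) (dilate-fromRoots h r n 0) ⟩
  0ℤ - h * r n * (h ^ n * d 0) ≡⟨ eq′ h (r n) (h ^ n) (d 0) ⟩
  h ^ suc n * (0ℤ - r n * d 0) ∎
  where
  open ≡-Reasoning
  c d : Poly
  c = fromRoots (λ e → h * r e) n
  d = fromRoots r n
  eq : ∀ h a x → 1ℤ * (0ℤ - h * a * x) ≡ 0ℤ - h * a * (1ℤ * x)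
  eq = solve-∀
  eq′ : ∀ h a hⁿ x → 0ℤ - h * a * (hⁿ * x) ≡ h * hⁿ * (0ℤ - a * x)
  eq′ = solve-∀
dilate-fromRoots h r (suc n) (suc k) = begin
  h ^ suc k * (c k - h * r n * c (suc k))
    ≡⟨ eq h (h ^ k) (r n) (c k) (c (suc k)) ⟩
  h * (h ^ k * c k) - h * r n * (h ^ suc k * c (suc k))
    ≡⟨ cong₂ (λ x y → h * x - h * r n * y) (dilate-fromRoots h r n k) (dilate-fromRoots h r n (suc k)) ⟩
  h * (h ^ n * d k) - h * r n * (h ^ n * d (suc k))
    ≡⟨ eq′ h (h ^ n) (r n) (d k) (d (suc k)) ⟩
  h ^ suc n * (d k - r n * d (suc k))
    ∎
  where
  open ≡-Reasoning
  c d : Poly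
  c = fromRoots (λ e → h * r e) n
  d = fromRoots r n
  eq : ∀ h hᵏ a x y → h * hᵏ * (x - h * a * y) ≡ h * (hᵏ * x) - h * a * (h * hᵏ * y)
  eq = solve-∀
  eq′ : ∀ h hⁿ a x y → h * (hⁿ * x) - h * a * (hⁿ * y) ≡ h * hⁿ * (x - a * y)
  eq′ = solve-∀

coeffSum-mulRoot : ∀ a c n → coeffSum (mulRoot a c) (suc n) ≡ coeffSum c n - a * coeffSum c (suc n)
coeffSum-mulRoot a c zero    = eq a (c 0)
  where
  eq : ∀ a x → 0ℤ + (0ℤ - a * x) ≡ 0ℤ - a * (0ℤ + x)
  eq = solve-∀
coeffSum-mulRoot a c (suc n) = begin
  coeffSum (mulRoot a c) (suc n) + (c n - a * c (suc n))
    ≡⟨ cong (_+ (c n - a * c (suc n))) (coeffSum-mulRoot a c n) ⟩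
  coeffSum c n - a * coeffSum c (suc n) + (c n - a * c (suc n))
    ≡⟨ eq a (coeffSum c n) (c n) (c (suc n)) ⟩
  coeffSum c (suc n) - a * coeffSum c (suc (suc n))
    ∎
  where
  open ≡-Reasoning
  eq : ∀ a s x y → s - a * (s + x) + (x - a * y) ≡ (s + x) - a * ((s + x) + y)
  eq = solve-∀

coeffSum-fromRoots : ∀ r n → coeffSum (fromRoots r n) (suc n) ≡ ∏[ e < n ] (1ℤ - r e)
coeffSum-fromRoots r zero    = refl
coeffSum-fromRoots r (suc n) = begin
  coeffSum (mulRoot (r n) c) (suc (suc n))
    ≡⟨ coeffSum-mulRoot (r n) c (suc n) ⟩
  coeffSum c (suc n) - r n * (coeffSum c (suc n) + c (suc n))
    ≡⟨ cong (λ x → coeffSum c (suc n) - r n * (coeffSum c (suc n) + x)) (fromRoots-vanishes r n ℕ.≤-refl) ⟩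
  coeffSum c (suc n) - r n * (coeffSum c (suc n) + 0ℤ)
    ≡⟨ eq (r n) (coeffSum c (suc n)) ⟩
  coeffSum c (suc n) * (1ℤ - r n)
    ≡⟨ cong (_* (1ℤ - r n)) (coeffSum-fromRoots r n) ⟩
  ∏[ e < suc n ] (1ℤ - r e)
    ∎
  where
  open ≡-Reasoning
  c : Poly
  c = fromRoots r n
  eq : ∀ a s → s - a * (s + 0ℤ) ≡ s * (1ℤ - a)
  eq = solve-∀

coeffSum-one : ∀ n → coeffSum (λ _ → 1ℤ) n ≡ + n
coeffSum-one zero    = refl
coeffSum-one (suc n) = trans (cong (_+ 1ℤ) (coeffSum-one n)) (trans (sym (ℤ.pos-+ n 1)) (cong +_ (ℕ.+-comm n 1)))

module _ {p : ℕ} where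
  open Congruence p

  coeffSum-cong-≈ : ∀ n {c d : Poly} → (∀ {k} → k < n → c k ≈ d k) → coeffSum c n ≈ coeffSum d n
  coeffSum-cong-≈ zero    c≈d = ≈-refl
  coeffSum-cong-≈ (suc n) c≈d = +-cong (coeffSum-cong-≈ n (λ k<n → c≈d (ℕ.m<n⇒m<1+n k<n))) (c≈d ℕ.≤-refl)

  ∏[1-hᵉ]≈order : Prime p → ∀ {h d} → h ^ suc d ≈ 1ℤ → (∀ {j} → 0 < j → j ≤ d → ¬ h ^ j ≈ 1ℤ) →
                 ∏[ e < d ] (1ℤ - h ^ suc e) ≈ + suc d
  ∏[1-hᵉ]≈order p-prime {h} {d} hⁿ≈1 hʲ≉1 = begin
    ∏[ e < d ] (1ℤ - h ^ suc e)  ≡⟨ coeffSum-fromRoots (λ e → h ^ suc e) d ⟨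
    coeffSum g (suc d)           ≈⟨ coeffSum-cong-≈ (suc d) (λ k<n → g≈1 (ℕ.≤-pred k<n)) ⟩
    coeffSum (λ _ → 1ℤ) (suc d)  ≡⟨ coeffSum-one (suc d) ⟩
    + suc d                      ∎
    where
    open SetoidReasoning setoid
    g f : Poly
    g = fromRoots (λ e → h ^ suc e) d
    f = mulRoot 1ℤ g

    f-dilation-invariant : ∀ k → h ^ k * f k ≈ f k
    f-dilation-invariant k = begin
      h ^ k * f k                       ≈⟨ *-congˡ (h ^ k) (-‿cong (≈-refl {shift g k}) (*-congʳ (g k) (≈-sym hⁿ≈1))) ⟩
      h ^ k * mulRoot (h ^ suc d) g k   ≡⟨ dilate-fromRoots h (h ^_) (suc d) k ⟩
      h ^ suc d * fromRoots (h ^_) (suc d) k ≡⟨ cong (h ^ suc d *_) (fromRoots-front (h ^_) d k) ⟩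
      h ^ suc d * f k                   ≈⟨ *-congʳ (f k) hⁿ≈1 ⟩
      1ℤ * f k                          ≡⟨ ℤ.*-identityˡ (f k) ⟩
      f k                               ∎

    g-step : ∀ {j} → j < d → g j ≈ g (suc j)
    g-step {j} j<d = [ (λ hʲ≈1 → ⊥-elim (hʲ≉1 (s≤s z≤n) j<d hʲ≈1)) , f≈0⇒g≈g ]′
                       (x*y≈y⇒x≈1∨y≈0 p-prime (f-dilation-invariant (suc j)))
      where
      f≈0⇒g≈g : f (suc j) ≈ 0ℤ → g j ≈ g (suc j)
      f≈0⇒g≈g fʲ≈0 = x-y≈0⇒x≈y (≈-trans (≈-reflexive (cong (λ x → g j - x) (sym (ℤ.*-identityˡ (g (suc j)))))) fʲ≈0)

    g≈1 : ∀ {j} → j ≤ d → g j ≈ 1ℤ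
    g≈1 j≤d = ≈-trans (steps≈⇒≈last g d g-step j≤d) (≈-reflexive (fromRoots-monic _ d))

module EvenPowers (G : ℤ) where

  E : ℕ → ℤ
  E k = ∏[ e < k ] (G ^ (2 ℕ.* suc e) - 1ℤ)

  vandermonde-row : ∀ j → ∏[ i < j ] (G ^ (2 ℕ.* suc j) - G ^ (2 ℕ.* suc i)) ≡ G ^ (j ℕ.* (j ℕ.+ 1)) * E j
  vandermonde-row j = begin
    ∏[ i < j ] (G ^ (2 ℕ.* suc j) - G ^ (2 ℕ.* suc i))
      ≡⟨ ∏-cong j factor ⟩
    ∏[ i < j ] (G ^ (2 ℕ.* suc i) * (G ^ (2 ℕ.* suc (j ∸ suc i)) - 1ℤ))
      ≡⟨ ∏-* j (λ i → G ^ (2 ℕ.* suc i)) (λ i → G ^ (2 ℕ.* suc (j ∸ suc i)) - 1ℤ) ⟩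
    ∏[ i < j ] (G ^ (2 ℕ.* suc i)) * ∏[ i < j ] (G ^ (2 ℕ.* suc (j ∸ suc i)) - 1ℤ)
      ≡⟨ cong₂ _*_ (trans (∏-^ j G _) (cong (G ^_) (∑-arithmetic 0 j))) (∏-reverse j _) ⟩
    G ^ (j ℕ.* (j ℕ.+ 1)) * E j
      ∎
    where
    open ≡-Reasoning
    factor : ∀ {i} → i < j → G ^ (2 ℕ.* suc j) - G ^ (2 ℕ.* suc i) ≡ G ^ (2 ℕ.* suc i) * (G ^ (2 ℕ.* suc (j ∸ suc i)) - 1ℤ)
    factor {i} i<j = begin
      G ^ (2 ℕ.* suc j) - G ^ (2 ℕ.* suc i)
        ≡⟨ cong (λ e → G ^ (2 ℕ.* e) - G ^ (2 ℕ.* suc i)) j+1≡ ⟩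
      G ^ (2 ℕ.* (suc i ℕ.+ suc (j ∸ suc i))) - G ^ (2 ℕ.* suc i)
        ≡⟨ cong (λ x → x - G ^ (2 ℕ.* suc i)) (trans (cong (G ^_) (ℕ.*-distribˡ-+ 2 (suc i) (suc (j ∸ suc i)))) (ℤ.^-distribˡ-+-* G (2 ℕ.* suc i) (2 ℕ.* suc (j ∸ suc i)))) ⟩
      G ^ (2 ℕ.* suc i) * G ^ (2 ℕ.* suc (j ∸ suc i)) - G ^ (2 ℕ.* suc i)
        ≡⟨ eq (G ^ (2 ℕ.* suc i)) _ ⟩
      G ^ (2 ℕ.* suc i) * (G ^ (2 ℕ.* suc (j ∸ suc i)) - 1ℤ)
        ∎
      where
      j+1≡ : suc j ≡ suc i ℕ.+ suc (j ∸ suc i)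
      j+1≡ = sym (trans (ℕ.+-suc (suc i) _) (cong suc (ℕ.m+[n∸m]≡n i<j)))
      eq : ∀ x y → x * y - x ≡ x * (y - 1ℤ)
      eq = solve-∀

  pairProd-even-powers : ∀ n → pairProd (λ i j → G ^ (2 ℕ.* j) - G ^ (2 ℕ.* i)) n ≡ G ^ ∑[ j < n ] (j ℕ.* (j ℕ.+ 1)) * ∏ n E
  pairProd-even-powers n = begin
    pairProd _ n                                       ≡⟨ pairProd≡∏ _ n ⟩
    ∏[ j < n ] innerProd _ (suc j) j                   ≡⟨ ∏-cong n (λ {j} _ → trans (innerProd≡∏ _ (suc j) j) (vandermonde-row j)) ⟩
    ∏[ j < n ] (G ^ (j ℕ.* (j ℕ.+ 1)) * E j)           ≡⟨ ∏-* n _ E ⟩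
    ∏[ j < n ] (G ^ (j ℕ.* (j ℕ.+ 1))) * ∏ n E           ≡⟨ cong (_* ∏ n E) (∏-^ n G _) ⟩
    G ^ ∑[ j < n ] (j ℕ.* (j ℕ.+ 1)) * ∏ n E           ∎
    where open ≡-Reasoning

module _ {p : ℕ} where
  open Congruence p

  module _ {G : ℤ} {d : ℕ} (Gⁿ≈-1 : G ^ suc d ≈ -1ℤ) where
    open EvenPowers G

    private
      n : ℕ
      n = suc d

    reflect : ∀ a b → a ℕ.+ b ≡ n → G ^ (2 ℕ.* a) - 1ℤ ≈ G ^ (n ℕ.+ 2 ℕ.* a) * (G ^ (2 ℕ.* b) - 1ℤ)
    reflect a b a+b≡n = ≈-sym (begin
      G ^ (n ℕ.+ 2 ℕ.* a) * (G ^ (2 ℕ.* b) - 1ℤ)  ≡⟨ cong (_* (z - 1ℤ)) (ℤ.^-distribˡ-+-* G n (2 ℕ.* a)) ⟩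
      x * y * (z - 1ℤ)                            ≡⟨ eq x y z ⟩
      x * (y * z) - x * y                         ≡⟨ cong (λ w → x * w - x * y) y*z≡x*x ⟩
      x * (x * x) - x * y                         ≈⟨ -‿cong (*-cong Gⁿ≈-1 (*-cong Gⁿ≈-1 Gⁿ≈-1)) (*-congʳ y Gⁿ≈-1) ⟩
      -1ℤ * (-1ℤ * -1ℤ) - -1ℤ * y                 ≡⟨ eq′ y ⟩
      y - 1ℤ                                      ∎)
      where
      open SetoidReasoning setoid
      x y z : ℤ
      x = G ^ n
      y = G ^ (2 ℕ.* a)
      z = G ^ (2 ℕ.* b)
      2a+2b≡n+n : ∀ a b → 2 ℕ.* a ℕ.+ 2 ℕ.* b ≡ (a ℕ.+ b) ℕ.+ (a ℕ.+ b)
      2a+2b≡n+n = ℕ-Solver.solve-∀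
      y*z≡x*x : y * z ≡ x * x
      y*z≡x*x = trans (sym (ℤ.^-distribˡ-+-* G (2 ℕ.* a) (2 ℕ.* b)))
                (trans (cong (G ^_) (trans (2a+2b≡n+n a b) (cong₂ ℕ._+_ a+b≡n a+b≡n)))
                       (ℤ.^-distribˡ-+-* G n n))
      eq : ∀ x y z → x * y * (z - 1ℤ) ≡ x * (y * z) - x * y
      eq = solve-∀
      eq′ : ∀ y → -1ℤ * (-1ℤ * -1ℤ) - -1ℤ * y ≡ y - 1ℤ
      eq′ = solve-∀

    E-pair : ∀ {k s} → k ℕ.+ s ≡ d → E k * E s ≈ E d * G ^ (s ℕ.* (s ℕ.+ suc n))
    E-pair {k} {s} k+s≡d = begin
      E k * E s
        ≈⟨ *-congˡ (E k) (∏-cong-≈ s (λ {t} t<s → reflect (suc t) (suc (k ℕ.+ (s ∸ suc t))) (indices t<s))) ⟩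
      E k * ∏[ t < s ] (G ^ (n ℕ.+ 2 ℕ.* suc t) * w (k ℕ.+ (s ∸ suc t)))
        ≡⟨ cong (E k *_) (∏-* s _ _) ⟩
      E k * (∏[ t < s ] (G ^ (n ℕ.+ 2 ℕ.* suc t)) * ∏[ t < s ] w (k ℕ.+ (s ∸ suc t)))
        ≡⟨ cong₂ (λ x y → E k * (x * y)) (trans (∏-^ s G _) (cong (G ^_) (∑-arithmetic n s))) (∏-reverse s (λ t → w (k ℕ.+ t))) ⟩
      E k * (G ^ (s ℕ.* (s ℕ.+ suc n)) * ∏[ t < s ] w (k ℕ.+ t))
        ≡⟨ swap (E k) (G ^ (s ℕ.* (s ℕ.+ suc n))) _ ⟩
      E k * ∏[ t < s ] w (k ℕ.+ t) * G ^ (s ℕ.* (s ℕ.+ suc n))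
        ≡⟨ cong (_* G ^ (s ℕ.* (s ℕ.+ suc n))) (trans (sym (∏-+ k s w)) (cong E k+s≡d)) ⟩
      E d * G ^ (s ℕ.* (s ℕ.+ suc n))
        ∎
      where
      open SetoidReasoning setoid
      w : ℕ → ℤ
      w e = G ^ (2 ℕ.* suc e) - 1ℤ
      shuffle : ∀ t k x → suc t ℕ.+ suc (k ℕ.+ x) ≡ suc (k ℕ.+ (suc t ℕ.+ x))
      shuffle = ℕ-Solver.solve-∀
      indices : ∀ {t} → t < s → suc t ℕ.+ suc (k ℕ.+ (s ∸ suc t)) ≡ n
      indices {t} t<s = trans (shuffle t k (s ∸ suc t)) (cong suc (trans (cong (k ℕ.+_) (ℕ.m+[n∸m]≡n t<s)) k+s≡d))
      swap : ∀ x y z → x * (y * z) ≡ x * z * y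
      swap = solve-∀

module _ {p : ℕ} (p-prime : Prime p) {G : ℤ} {r : ℕ}
         (G⁴ᵐ≡1 : (G ^ (suc r ℕ.* 4)) ≡ 1ℤ [mod p ])
         (G-primitive : ∀ k → 1 ≤ k → k < suc r ℕ.* 4 → ¬ (G ^ k) ≡ 1ℤ [mod p ]) where
  open Congruence p
  open Exponents r
  open EvenPowers G

  private
    4m≡n+n : suc r ℕ.* 4 ≡ n ℕ.+ n
    4m≡n+n = solve r
      where
      solve : ∀ r → suc r ℕ.* 4 ≡ (suc r ℕ.+ suc r) ℕ.+ (suc r ℕ.+ suc r)
      solve = ℕ-Solver.solve-∀

    2*n≡n+n : 2 ℕ.* n ≡ n ℕ.+ n
    2*n≡n+n = cong (n ℕ.+_) (ℕ.+-identityʳ n)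

    G²ⁿ≈1 : G ^ (n ℕ.+ n) ≈ 1ℤ
    G²ⁿ≈1 = ≈-trans (≈-reflexive (cong (G ^_) (sym 4m≡n+n))) (fromMod G⁴ᵐ≡1)

    Gᵏ≉1 : ∀ {k} → 0 < k → k < n ℕ.+ n → ¬ G ^ k ≈ 1ℤ
    Gᵏ≉1 {k} 0<k k<2n Gᵏ≈1 = G-primitive k 0<k (subst (k <_) (sym 4m≡n+n) k<2n) (toMod Gᵏ≈1)

    Gⁿ≈-1 : G ^ n ≈ -1ℤ
    Gⁿ≈-1 = [ (λ Gⁿ≈1 → ⊥-elim (Gᵏ≉1 (s≤s z≤n) (ℕ.m<m+n n (s≤s z≤n)) Gⁿ≈1)) , id ]′
              (x*x≈1⇒x≈±1 p-prime (≈-trans (≈-reflexive (sym (ℤ.^-distribˡ-+-* G n n))) G²ⁿ≈1))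

    h : ℤ
    h = G ^ 2

    hⁿ≈1 : h ^ n ≈ 1ℤ
    hⁿ≈1 = ≈-trans (≈-reflexive (trans (ℤ.^-*-assoc G 2 n) (cong (G ^_) 2*n≡n+n))) G²ⁿ≈1

    hʲ≉1 : ∀ {j} → 0 < j → j ≤ d → ¬ h ^ j ≈ 1ℤ
    hʲ≉1 {j} 0<j j≤d hʲ≈1 =
      Gᵏ≉1 (ℕ.*-monoʳ-< 2 0<j) (subst (2 ℕ.* j <_) 2*n≡n+n (ℕ.*-monoʳ-< 2 (s≤s j≤d)))
           (≈-trans (≈-reflexive (sym (ℤ.^-*-assoc G 2 j))) hʲ≈1)

    E-last≈ : E d ≈ G ^ (n ℕ.* d) * + n
    E-last≈ = begin
      E d                                     ≡⟨ ∏-cong d (λ {e} _ → factor e) ⟩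
      ∏[ e < d ] (-1ℤ * (1ℤ - h ^ suc e))     ≡⟨ ∏-* d (λ _ → -1ℤ) (λ e → 1ℤ - h ^ suc e) ⟩
      ∏[ e < d ] -1ℤ * ∏[ e < d ] (1ℤ - h ^ suc e)
                                              ≡⟨ cong (_* ∏[ e < d ] (1ℤ - h ^ suc e)) (∏-const d -1ℤ) ⟩
      -1ℤ ^ d * ∏[ e < d ] (1ℤ - h ^ suc e)   ≈⟨ *-cong (^-cong d (≈-sym Gⁿ≈-1)) (∏[1-hᵉ]≈order p-prime hⁿ≈1 hʲ≉1) ⟩
      (G ^ n) ^ d * + n                       ≡⟨ cong (_* + n) (ℤ.^-*-assoc G n d) ⟩
      G ^ (n ℕ.* d) * + n                     ∎
      where
      open SetoidReasoning setoid
      eq : ∀ x → x - 1ℤ ≡ -1ℤ * (1ℤ - x)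
      eq = solve-∀
      factor : ∀ e → G ^ (2 ℕ.* suc e) - 1ℤ ≡ -1ℤ * (1ℤ - h ^ suc e)
      factor e = trans (cong (_- 1ℤ) (sym (ℤ.^-*-assoc G 2 (suc e)))) (eq (h ^ suc e))

    ∏E-paired : ∏ n E ≈ E d ^ m * G ^ Q
    ∏E-paired = begin
      ∏ (m ℕ.+ m) E                                     ≡⟨ ∏-+ m m E ⟩
      ∏ m E * ∏[ i < m ] E (m ℕ.+ i)                    ≡⟨ cong (_* ∏[ i < m ] E (m ℕ.+ i)) (∏-reverse m E) ⟨
      ∏[ i < m ] E (m ∸ suc i) * ∏[ i < m ] E (m ℕ.+ i) ≡⟨ ∏-* m (λ i → E (m ∸ suc i)) (λ i → E (m ℕ.+ i)) ⟨
      ∏[ i < m ] (E (m ∸ suc i) * E (m ℕ.+ i))          ≈⟨ ∏-cong-≈ m (λ i<m → E-pair {G = G} {d = d} Gⁿ≈-1 (halves i<m)) ⟩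
      ∏[ i < m ] (E d * G ^ ((m ℕ.+ i) ℕ.* (m ℕ.+ i ℕ.+ suc n))) ≡⟨ ∏-* m (λ _ → E d) (λ i → G ^ ((m ℕ.+ i) ℕ.* (m ℕ.+ i ℕ.+ suc n))) ⟩
      ∏[ i < m ] E d * ∏[ i < m ] (G ^ ((m ℕ.+ i) ℕ.* (m ℕ.+ i ℕ.+ suc n))) ≡⟨ cong₂ _*_ (∏-const m (E d)) (∏-^ m G _) ⟩
      E d ^ m * G ^ Q                                   ∎
      where
      open SetoidReasoning setoid
      shuffle : ∀ x r i → x ℕ.+ (suc r ℕ.+ i) ≡ x ℕ.+ i ℕ.+ suc r
      shuffle = ℕ-Solver.solve-∀
      halves : ∀ {i} → i < m → (m ∸ suc i) ℕ.+ (m ℕ.+ i) ≡ d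
      halves {i} (s≤s i≤r) = trans (shuffle (r ∸ i) r i) (cong (ℕ._+ m) (ℕ.m∸n+n≡m i≤r))

  pairProd-even-powers≈ : pairProd (λ i j → G ^ (2 ℕ.* j) - G ^ (2 ℕ.* i)) n ≈ (G ^ m) ^ K * (+ n) ^ m
  pairProd-even-powers≈ = begin
    pairProd (λ i j → G ^ (2 ℕ.* j) - G ^ (2 ℕ.* i)) n ≡⟨ pairProd-even-powers n ⟩
    G ^ S * ∏ n E                                    ≈⟨ *-congˡ (G ^ S) (≈-trans ∏E-paired (*-congʳ (G ^ Q) (^-cong m E-last≈))) ⟩
    G ^ S * ((G ^ (n ℕ.* d) * + n) ^ m * G ^ Q)      ≡⟨ cong (λ y → G ^ S * (y * G ^ Q)) (^-distribʳ-* (G ^ (n ℕ.* d)) (+ n) m) ⟩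
    G ^ S * ((G ^ (n ℕ.* d)) ^ m * (+ n) ^ m * G ^ Q) ≡⟨ cong (λ y → G ^ S * (y * (+ n) ^ m * G ^ Q)) (ℤ.^-*-assoc G (n ℕ.* d) m) ⟩
    G ^ S * (G ^ (n ℕ.* d ℕ.* m) * (+ n) ^ m * G ^ Q) ≡⟨ swap (G ^ S) (G ^ (n ℕ.* d ℕ.* m)) ((+ n) ^ m) (G ^ Q) ⟩
    G ^ S * G ^ (n ℕ.* d ℕ.* m) * G ^ Q * (+ n) ^ m  ≡⟨ cong (λ y → y * G ^ Q * (+ n) ^ m) (ℤ.^-distribˡ-+-* G S (n ℕ.* d ℕ.* m)) ⟨
    G ^ (S ℕ.+ n ℕ.* d ℕ.* m) * G ^ Q * (+ n) ^ m    ≡⟨ cong (_* (+ n) ^ m) (ℤ.^-distribˡ-+-* G (S ℕ.+ n ℕ.* d ℕ.* m) Q) ⟨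
    G ^ (S ℕ.+ n ℕ.* d ℕ.* m ℕ.+ Q) * (+ n) ^ m      ≡⟨ cong (λ e → G ^ e * (+ n) ^ m) S+ndm+Q≡mK+4mX ⟩
    G ^ (m ℕ.* K ℕ.+ (n ℕ.+ n) ℕ.* X) * (+ n) ^ m    ≈⟨ *-congʳ ((+ n) ^ m) (^-periodic {N = n ℕ.+ n} G²ⁿ≈1 (m ℕ.* K) X) ⟩
    G ^ (m ℕ.* K) * (+ n) ^ m                        ≡⟨ cong (_* (+ n) ^ m) (ℤ.^-*-assoc G m K) ⟨
    (G ^ m) ^ K * (+ n) ^ m                          ∎
    where
    open SetoidReasoning setoid
    swap : ∀ a b y c → a * (b * y * c) ≡ a * b * c * y
    swap = solve-∀

p≡1+[p/4]*4 : ∀ p → p % 4 ≡ 1 → p ≡ suc (p / 4 ℕ.* 4)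
p≡1+[p/4]*4 p p%4≡1 = trans (m≡m%n+[m/n]*n p 4) (cong (ℕ._+ p / 4 ℕ.* 4) p%4≡1)

lemma2p2 : (p g : ℕ) → Prime p → p % 4 ≡ 1 → 1 ≤ g → g ≤ p ∸ 1 → PrimitiveRoot p g →
    lhs p g ≡ rhs p g [mod p ]
lemma2p2 p g p-prime p%4≡1 _ _ (gᵖ⁻¹≡1 , g-primitive) with p / 4 | p≡1+[p/4]*4 p p%4≡1
... | zero  | p≡1  = ⊥-elim (¬prime[1] (subst Prime p≡1 p-prime))
... | suc r | refl = Congruence.toMod (begin
  lhs P g                                              ≡⟨ cong (pairProd _) [P-1]/2≡n ⟩
  pairProd (λ i j → G ^ (2 ℕ.* j) - G ^ (2 ℕ.* i)) n  ≈⟨ pairProd-even-powers≈ p-prime {G} {r} gᵖ⁻¹≡1 g-primitive ⟩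
  (G ^ m) ^ K * (+ n) ^ m                              ≡⟨ rhs≡ ⟨
  rhs P g                                              ∎)
  where
  open Exponents r
  open Congruence P
  open SetoidReasoning setoid
  G : ℤ
  G = + g
  rhs≡ : rhs P g ≡ (G ^ m) ^ K * (+ n) ^ m
  rhs≡ = trans (cong₂ (λ a b → (G ^ a) ^ b * (+ ((P ∸ 1) / 2)) ^ a) [P-1]/4≡m [P-3][3P+1]/8≡K)
               (cong (λ c → (G ^ m) ^ K * (+ c) ^ m) [P-1]/2≡n)
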